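{- Let $f:\subseteq X\rightrightarrows Y$ be a problem and $P\in\{\mathrm I,\mathrm{II}\}$. The following are equivalent: (1) Player $P$ has a winning strategy for the Wadge game $f$; (2) Player $P$ has a winning strategy for the Lipschitz game $f^{\mathrm{rw}}$; (3) Player $P$ has a winning strategy for the Gale–Stewart game $\langle\mathrm{graph}(\mathrm T(f^{\mathrm{rw}}))\rangle$.
   Context: A represented space is $(X,\delta_X)$ with $\delta_X:\subseteq\mathbb{N}^\mathbb{N}\to X$ a partial surjection; a problem $f:\subseteq X\rightrightarrows Y$ is a partial multivalued function with a realizer; its realizer version is $f^{\mathrm r}:=\delta_Y^{ -1}\circ f\circ\delta_X:\subseteq\mathbb{N}^\mathbb{N}\rightrightarrows\mathbb{N}^\mathbb{N}$. Let $\mathrm w:\mathbb{N}\to\mathbb{N}^*$ be a canonical bijective numbering of finite words, lifted to $\mathrm w:\subseteq\mathbb{N}^\mathbb{N}\to\mathbb{N}^\mathbb{N}$, $p\mapsto\mathrm w_{p(0)}\mathrm w_{p(1)}\dots$ (defined when this is infinite); for $g:\subseteq\mathbb{N}^\mathbb{N}\rightrightarrows\mathbb{N}^\mathbb{N}$, $g^{\mathrm w}:=\mathrm w^{ -1}\circ g\circ\mathrm w$, and $f^{\mathrm{rw}}:=(f^{\mathrm r})^{\mathrm w}$. Totalization: $\mathrm Tg(x)=g(x)$ for $x\in\mathrm{dom}(g)$ and $=\mathbb{N}^\mathbb{N}$ otherwise. Pairing $\langle p,q\rangle(2n)=p(n)$, $\langle p,q\rangle(2n+1)=q(n)$, and $\langle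 R\rangle:=\{\langle p,q\rangle:(p,q)\in R\}$. Wadge game of $g$: I and II alternately play finite words $x_0,y_0,x_1,\dots$ (I starts); with $x=x_0x_1\dots$, $y=y_0y_1\dots$, II wins iff $(x,y)\in\mathrm{graph}(g)$ or $x\notin\mathrm{dom}(g)$. The Wadge game of $f$ is that of $f^{\mathrm r}$. Lipschitz game: the same with moves in $\mathbb{N}$. Gale–Stewart game on $A\subseteq\mathbb{N}^\mathbb{N}$: players alternately play numbers, II wins iff $\langle x,y\rangle\in A$. Strategies map the opponent's previous moves to the next move (II: $y_i=\sigma(x_0,\dots,x_i)$; I: $x_i=\sigma(y_0,\dots,y_{i-1})$) and are winning if the player wins every run played according to them. -}

module Defs where

open import Data.Nat using (ℕ; zero; suc; _<_)
open import Data.List using (List; []; _∷_; _++_; length; _∷ʳ_)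
open import Data.Product using (Σ; ∃; _×_; _,_)
open import Data.Unit using (⊤)
open import Relation.Nullary using (¬_)
open import Relation.Binary.PropositionalEquality using (_≡_)
open import Function.Bundles using (_↔_; Inverse)

Baire : Set
Baire = ℕ → ℕ

_≈_ : Baire → Baire → Set
p ≈ q = ∀ n → p n ≡ q n

-- Partial multivalued maps A ⇉ B, given by their graph.
-- dom g = { a | g(a) ≠ ∅ }.

MV : Set → Set → Set₁
MV A B = A → B → Set

dom : {A B : Set} → MV A B → A → Set
dom g a = ∃ λ b → g a b

-- Represented spaces (X, δ_X), δ_X :⊆ ℕ^ℕ → X a partial surjection,
-- given by its graph (single-valued, surjective, respecting equality
-- of points of Baire space).

record RepSpace : Set₁ where
  field
    Carrier       : Set
    δ             : Baire → Carrier → Set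
    δ-functional  : ∀ {p x x′} → δ p x → δ p x′ → x ≡ x′
    δ-surjective  : ∀ x → ∃ λ p → δ p x
    δ-extensional : ∀ {p q x} → p ≈ q → δ p x → δ q x

open RepSpace public

record Problem (X Y : RepSpace) : Set₁ where
  field
    graph    : MV (Carrier X) (Carrier Y)
    realizer : ∀ p x → δ X p x → dom graph x →
               Σ Baire λ q → ∃ λ y → δ Y q y × graph x y

open Problem public

_ʳ : {X Y : RepSpace} → Problem X Y → MV Baire Baire
_ʳ {X} {Y} f p q = ∃ λ x → ∃ λ y → δ X p x × δ Y q y × graph f x y

pre : (ℕ → List ℕ) → ℕ → List ℕ
pre s zero    = []
pre s (suc m) = pre s m ++ s m

_≺_ : List ℕ → Baire → Set
[]      ≺ x = ⊤
(a ∷ l) ≺ x = (a ≡ x 0) × (l ≺ (λ n → x (suc n)))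

-- Concat s x : the concatenation s 0 s 1 s 2 ... is infinite and equals x
Concat : (ℕ → List ℕ) → Baire → Set
Concat s x = (∀ m → pre s m ≺ x) × (∀ n → ∃ λ m → n < length (pre s m))

wlift : (ℕ ↔ List ℕ) → MV Baire Baire
wlift w p x = Concat (λ n → Inverse.to w (p n)) x

_ʷ⟨_⟩ : MV Baire Baire → (ℕ ↔ List ℕ) → MV Baire Baire
(g ʷ⟨ w ⟩) p q = ∃ λ x → ∃ λ y → wlift w p x × wlift w q y × g x y

_ʳʷ⟨_⟩ : {X Y : RepSpace} → Problem X Y → (ℕ ↔ List ℕ) → MV Baire Baire
f ʳʷ⟨ w ⟩ = (f ʳ) ʷ⟨ w ⟩

-- Totalization: Tg(x) = g(x) for x ∈ dom g, = ℕ^ℕ otherwise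
T : MV Baire Baire → MV Baire Baire
T g x y = dom g x → g x y

-- Pairing ⟨p,q⟩(2n) = p(n), ⟨p,q⟩(2n+1) = q(n)
pair : Baire → Baire → Baire
pair p q zero          = p 0
pair p q (suc zero)    = q 0
pair p q (suc (suc n)) = pair (λ k → p (suc k)) (λ k → q (suc k)) n

⟨_⟩ : MV Baire Baire → Baire → Set
⟨ R ⟩ z = ∃ λ p → ∃ λ q → (pair p q ≈ z) × R p q

-- Games: I and II alternately play moves x_0, y_0, x_1, y_1, ... (I starts).
-- IIwins xs ys : player II wins the run; player I wins iff II does not.

record Game : Set₁ where
  field
    Move   : Set
    IIwins : (ℕ → Move) → (ℕ → Move) → Set

open Game public

initial : {M : Set} → (ℕ → M) → ℕ → List M
initial s zero    = []
initial s (suc n) = initial s n ∷ʳ s n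

Strategy : Set → Set
Strategy M = List M → M

playII : {M : Set} → Strategy M → (ℕ → M) → (ℕ → M)
playII σ xs i = σ (initial xs (suc i))

playI : {M : Set} → Strategy M → (ℕ → M) → (ℕ → M)
playI τ ys i = τ (initial ys i)

data Player : Set where
  I II : Player

HasWinningStrategy : Player → Game → Set
HasWinningStrategy I  G = Σ (Strategy (Move G)) λ τ → ∀ ys → ¬ IIwins G (playI τ ys) ys
HasWinningStrategy II G = Σ (Strategy (Move G)) λ σ → ∀ xs → IIwins G xs (playII σ xs)

WadgeGame : MV Baire Baire → Game
WadgeGame g = record
  { Move   = List ℕ
  ; IIwins = λ xs ys → ∀ x → Concat xs x → dom g x →
                       ∃ λ y → Concat ys y × g x y
  }

WadgeGameᵖ : {X Y : RepSpace} → Problem X Y → Game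
WadgeGameᵖ f = WadgeGame (f ʳ)

LipschitzGame : MV Baire Baire → Game
LipschitzGame g = record
  { Move   = ℕ
  ; IIwins = λ x y → dom g x → g x y
  }

GaleStewartGame : (Baire → Set) → Game
GaleStewartGame A = record
  { Move   = ℕ
  ; IIwins = λ x y → A (pair x y)
  }

{-# OPTIONS --safe #-}
-- All three games are one game up to a renaming of the moves. Any bijection φ of move sets
-- under which the winning sets of two games correspond transports strategies (conjugate by φ)
-- and hence winning strategies of either player. The numbering w is such a bijection between
-- the moves of the Wadge game of fʳ and the Lipschitz game of fʳʷ, and the identity is one
-- between the Lipschitz game of g and the Gale–Stewart game on ⟨T g⟩, since ⟨x,y⟩ ∈ ⟨T g⟩
-- says precisely that y ∈ g(x) whenever x ∈ dom g. Runs of a conjugated strategy agree with the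
-- translated runs only pointwise, so each game must also have a winning condition invariant
-- under pointwise equality of runs.
module Submission where

open import Defs
open import Data.Nat using (ℕ; zero; suc; _<_; _+_; s≤s)
open import Data.Nat.Properties using (+-comm; n<1+n)
open import Data.List using (List; []; _∷_; _++_; length; _∷ʳ_; map; [_])
open import Data.List.Properties using (map-++; length-++)
open import Data.Product using (_×_; _,_; ∃)
open import Data.Unit using (tt)
open import Function using (_∘_)
open import Function.Bundles using (_↔_; _⇔_; mk⇔; Inverse; Equivalence)
open import Function.Construct.Identity using (↔-id)
open import Function.Construct.Symmetry using (↔-sym; ⇔-sym)
open import Relation.Binary.PropositionalEquality
  using (_≡_; _≗_; refl; sym; trans; cong; cong₂; subst)

open Inverse using (to; from; strictlyInverseˡ)
open Equivalence using () renaming (to to ⇒; from to ⇐)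

≺-agree : ∀ l {x x′} → l ≺ x → l ≺ x′ → ∀ n → n < length l → x n ≡ x′ n
≺-agree (a ∷ l) (a≡ , _) (a≡′ , _) zero    _       = trans (sym a≡) a≡′
≺-agree (a ∷ l) (_ , l≺) (_ , l≺′) (suc n) (s≤s n<) = ≺-agree l l≺ l≺′ n n<

≺-∷ʳ : ∀ l {x} → l ≺ x → (l ∷ʳ x (length l)) ≺ x
≺-∷ʳ []      _          = refl , tt
≺-∷ʳ (a ∷ l) (a≡ , l≺) = a≡ , ≺-∷ʳ l l≺

pre-cong : ∀ {s s′} → s ≗ s′ → pre s ≗ pre s′
pre-cong e zero    = refl
pre-cong e (suc m) = cong₂ _++_ (pre-cong e m) (e m)

Concat-cong : ∀ {s s′ x} → s ≗ s′ → Concat s x → Concat s′ x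
Concat-cong {x = x} e (prefixes , unbounded) =
  (λ m → subst (_≺ x) (pre-cong e m) (prefixes m)) ,
  (λ n → let m , n< = unbounded n in m , subst (λ l → n < length l) (pre-cong e m) n<)

Concat-unique : ∀ {s x x′} → Concat s x → Concat s x′ → x ≈ x′
Concat-unique {s} (prefixes , unbounded) (prefixes′ , _) n =
  let m , n< = unbounded n in ≺-agree (pre s m) (prefixes m) (prefixes′ m) n n<

module _ (y : Baire) where

  singletons : ℕ → List ℕ
  singletons n = [ y n ]

  length-pre-singletons : ∀ m → length (pre singletons m) ≡ m
  length-pre-singletons zero    = refl
  length-pre-singletons (suc m) =
    trans (length-++ (pre singletons m)) (trans (cong (_+ 1) (length-pre-singletons m)) (+-comm m 1))

  pre-singletons-≺ : ∀ m → pre singletons m ≺ y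
  pre-singletons-≺ zero    = tt
  pre-singletons-≺ (suc m) =
    subst (λ k → (pre singletons m ∷ʳ y k) ≺ y) (length-pre-singletons m)
          (≺-∷ʳ (pre singletons m) (pre-singletons-≺ m))

  Concat-singletons : Concat singletons y
  Concat-singletons =
    pre-singletons-≺ ,
    λ n → suc n , subst (n <_) (sym (length-pre-singletons (suc n))) (n<1+n n)

double : ℕ → ℕ
double zero    = zero
double (suc n) = suc (suc (double n))

pair-double : ∀ p q n → pair p q (double n) ≡ p n
pair-double p q zero    = refl
pair-double p q (suc n) = pair-double (p ∘ suc) (q ∘ suc) n

pair-suc-double : ∀ p q n → pair p q (suc (double n)) ≡ q n
pair-suc-double p q zero    = refl
pair-suc-double p q (suc n) = pair-suc-double (p ∘ suc) (q ∘ suc) n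

pair-cong : ∀ {p p′ q q′} → p ≈ p′ → q ≈ q′ → pair p q ≈ pair p′ q′
pair-cong ep eq zero          = ep 0
pair-cong ep eq (suc zero)    = eq 0
pair-cong ep eq (suc (suc n)) = pair-cong (ep ∘ suc) (eq ∘ suc) n

pair-injective : ∀ {p p′ q q′} → pair p q ≈ pair p′ q′ → (p ≈ p′) × (q ≈ q′)
pair-injective {p} {p′} {q} {q′} e =
  (λ n → trans (sym (pair-double p q n)) (trans (e (double n)) (pair-double p′ q′ n))) ,
  (λ n → trans (sym (pair-suc-double p q n)) (trans (e (suc (double n))) (pair-suc-double p′ q′ n)))

map-initial : ∀ {A B : Set} (h : A → B) (s : ℕ → A) n → map h (initial s n) ≡ initial (h ∘ s) n
map-initial h s zero    = refl
map-initial h s (suc n) = trans (map-++ h (initial s n) [ s n ]) (cong (_∷ʳ h (s n)) (map-initial h s n))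

conjugate : {A B : Set} → (A → B) → (B → A) → Strategy A → Strategy B
conjugate e d σ = e ∘ σ ∘ map d

playII-conjugate : ∀ {A B : Set} (e : A → B) (d : B → A) σ xs →
                   playII (conjugate e d σ) xs ≗ e ∘ playII σ (d ∘ xs)
playII-conjugate e d σ xs i = cong (e ∘ σ) (map-initial d xs (suc i))

playI-conjugate : ∀ {A B : Set} (e : A → B) (d : B → A) τ ys →
                  playI (conjugate e d τ) ys ≗ e ∘ playI τ (d ∘ ys)
playI-conjugate e d τ ys i = cong (e ∘ τ) (map-initial d ys i)

Extensional : Game → Set
Extensional G = ∀ {xs xs′ ys ys′} → xs ≗ xs′ → ys ≗ ys′ → IIwins G xs ys → IIwins G xs′ ys′

IsGameIsomorphism : (G H : Game) → Move G ↔ Move H → Set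
IsGameIsomorphism G H φ = ∀ xs ys → IIwins G xs ys ⇔ IIwins H (to φ ∘ xs) (to φ ∘ ys)

module _ {G H : Game} (φ : Move G ↔ Move H) (ext : Extensional H) (iso : IsGameIsomorphism G H φ) where

  private
    to∘from : ∀ (s : ℕ → Move H) → to φ ∘ from φ ∘ s ≗ s
    to∘from s i = strictlyInverseˡ φ (s i)

  HasWinningStrategy-transfer : ∀ P → HasWinningStrategy P G → HasWinningStrategy P H
  HasWinningStrategy-transfer I (τ , win) =
    conjugate (to φ) (from φ) τ ,
    λ ys IIwon → win (from φ ∘ ys)
      (⇐ (iso _ _) (ext (playI-conjugate (to φ) (from φ) τ ys) (sym ∘ to∘from ys) IIwon))
  HasWinningStrategy-transfer II (σ , win) =
    conjugate (to φ) (from φ) σ ,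
    λ xs → ext (to∘from xs) (sym ∘ playII-conjugate (to φ) (from φ) σ xs) (⇒ (iso _ _) (win (from φ ∘ xs)))

  IsGameIsomorphism-sym : IsGameIsomorphism H G (↔-sym φ)
  IsGameIsomorphism-sym xs ys =
    mk⇔ (⇐ (iso _ _) ∘ ext (sym ∘ to∘from xs) (sym ∘ to∘from ys))
        (ext (to∘from xs) (to∘from ys) ∘ ⇒ (iso _ _))

HasWinningStrategy-cong : ∀ {G H : Game} (φ : Move G ↔ Move H) → Extensional G → Extensional H →
                          IsGameIsomorphism G H φ → ∀ P → HasWinningStrategy P G ⇔ HasWinningStrategy P H
HasWinningStrategy-cong φ extG extH iso P =
  mk⇔ (HasWinningStrategy-transfer φ extH iso P)
      (HasWinningStrategy-transfer (↔-sym φ) extG (IsGameIsomorphism-sym φ extH iso) P)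

Congruent : MV Baire Baire → Set
Congruent g = ∀ {p p′ q q′} → p ≈ p′ → q ≈ q′ → g p q → g p′ q′

LipschitzGame-extensional : ∀ {g} → Congruent g → Extensional (LipschitzGame g)
LipschitzGame-extensional g-cong ep eq IIwon (q , gpq) =
  g-cong ep eq (IIwon (q , g-cong (sym ∘ ep) (λ _ → refl) gpq))

GaleStewartGame-⟨⟩-extensional : ∀ R → Extensional (GaleStewartGame ⟨ R ⟩)
GaleStewartGame-⟨⟩-extensional R ep eq (p , q , pq≈ , Rpq) =
  p , q , (λ n → trans (pq≈ n) (pair-cong ep eq n)) , Rpq

WadgeGame-extensional : ∀ g → Extensional (WadgeGame g)
WadgeGame-extensional g exs eys IIwon x xs′x gx =
  let y , ysy , gxy = IIwon x (Concat-cong (sym ∘ exs) xs′x) gx in y , Concat-cong eys ysy , gxy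

ʳ-congˡ : ∀ {X Y} (f : Problem X Y) {p p′ q} → p ≈ p′ → (f ʳ) p q → (f ʳ) p′ q
ʳ-congˡ {X} f e (x , y , px , qy , fxy) = x , y , δ-extensional X e px , qy , fxy

module _ (w : ℕ ↔ List ℕ) where

  wlift-surjective : ∀ y → ∃ λ p → wlift w p y
  wlift-surjective y =
    (λ n → from w [ y n ]) ,
    Concat-cong (λ n → sym (strictlyInverseˡ w [ y n ])) (Concat-singletons y)

  ʷ-congruent : ∀ g → Congruent (g ʷ⟨ w ⟩)
  ʷ-congruent g ep eq (x , y , px , qy , gxy) =
    x , y , Concat-cong (cong (to w) ∘ ep) px , Concat-cong (cong (to w) ∘ eq) qy , gxy

  LipschitzGame-WadgeGame-isomorphism :
    ∀ {g} → (∀ {x x′ y} → x ≈ x′ → g x y → g x′ y) → IsGameIsomorphism (LipschitzGame (g ʷ⟨ w ⟩)) (WadgeGame g) w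
  LipschitzGame-WadgeGame-isomorphism {g} g-cong p q = mk⇔ Lipschitz⇒Wadge Wadge⇒Lipschitz
    where
    Lipschitz⇒Wadge : IIwins (LipschitzGame (g ʷ⟨ w ⟩)) p q → IIwins (WadgeGame g) (to w ∘ p) (to w ∘ q)
    Lipschitz⇒Wadge IIwon x px (y , gxy) =
      let q₀ , q₀y = wlift-surjective y
          x′ , y′ , px′ , qy′ , gx′y′ = IIwon (q₀ , x , y , px , q₀y , gxy)
      in y′ , qy′ , g-cong (Concat-unique px′ px) gx′y′

    Wadge⇒Lipschitz : IIwins (WadgeGame g) (to w ∘ p) (to w ∘ q) → IIwins (LipschitzGame (g ʷ⟨ w ⟩)) p q
    Wadge⇒Lipschitz IIwon (_ , x , y , px , _ , gxy) =
      let y′ , qy′ , gxy′ = IIwon x px (y , gxy) in x , y′ , px , qy′ , gxy′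

LipschitzGame-GaleStewartGame-isomorphism :
  ∀ {g} → Congruent g → IsGameIsomorphism (LipschitzGame g) (GaleStewartGame ⟨ T g ⟩) (↔-id ℕ)
LipschitzGame-GaleStewartGame-isomorphism g-cong x y =
  mk⇔ (λ IIwon → x , y , (λ _ → refl) , IIwon)
      (λ { (p , q , pq≈xy , Tgpq) (r , gxr) →
           let p≈x , q≈y = pair-injective pq≈xy
           in g-cong p≈x q≈y (Tgpq (r , g-cong (sym ∘ p≈x) (λ _ → refl) gxr)) })

corollary33 : (w : ℕ ↔ List ℕ) {X Y : RepSpace} (f : Problem X Y) (P : Player) →
    (HasWinningStrategy P (WadgeGameᵖ f) ⇔ HasWinningStrategy P (LipschitzGame (f ʳʷ⟨ w ⟩)))
    × (HasWinningStrategy P (LipschitzGame (f ʳʷ⟨ w ⟩)) ⇔ HasWinningStrategy P (GaleStewartGame ⟨ T (f ʳʷ⟨ w ⟩) ⟩))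
corollary33 w f P =
  ⇔-sym (HasWinningStrategy-cong w Lipschitz-extensional (WadgeGame-extensional (f ʳ))
           (LipschitzGame-WadgeGame-isomorphism w (ʳ-congˡ f)) P) ,
  HasWinningStrategy-cong (↔-id ℕ) Lipschitz-extensional (GaleStewartGame-⟨⟩-extensional _)
    (LipschitzGame-GaleStewartGame-isomorphism (ʷ-congruent w (f ʳ))) P
  where
  Lipschitz-extensional : Extensional (LipschitzGame (f ʳʷ⟨ w ⟩))
  Lipschitz-extensional = LipschitzGame-extensional (ʷ-congruent w (f ʳ))
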